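{- For every integer $k\ge 2$, the polynomial $-1+3z-z^2-z^{k+1}$ has no multiple roots in $\mathbb{C}$. -}

module Defs where

open import Level using (Level; _⊔_) renaming (suc to lsuc)
open import Data.Nat using (ℕ; zero; suc)
open import Data.List using (List; []; _∷_; _∷ʳ_)
open import Data.Product using (∃; Σ; _×_)
open import Relation.Nullary using (¬_)
open import Algebra.Bundles using (CommutativeRing)

module Poly {c ℓ : Level} (R : CommutativeRing c ℓ) where
  open CommutativeRing R

  pow : Carrier → ℕ → Carrier
  pow x zero    = 1#
  pow x (suc n) = x * pow x n

  natC : ℕ → Carrier
  natC zero    = 0#
  natC (suc n) = 1# + natC n

  -- polynomial given by coefficient list, lowest degree first (Horner evaluation)
  eval : List Carrier → Carrier → Carrier
  eval []       z = 0#
  eval (a ∷ as) z = a + z * eval as z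

  -- a is a multiple root of the polynomial function p :
  -- p(z) = (z - a)^2 q(z) for some polynomial q
  -- (over an infinite field, equality of polynomial functions = equality of polynomials)
  IsMultipleRoot : (Carrier → Carrier) → Carrier → Set (c ⊔ ℓ)
  IsMultipleRoot p a =
    ∃ λ (q : List Carrier) → ∀ z → p z ≈ ((z - a) * (z - a)) * eval q z

  HasNoMultipleRoots : (Carrier → Carrier) → Set (c ⊔ ℓ)
  HasNoMultipleRoots p = ∀ a → ¬ IsMultipleRoot p a

-- An algebraically closed field of characteristic 0 (the role played by ℂ).
record ACF₀ (c ℓ : Level) : Set (lsuc (c ⊔ ℓ)) where
  field
    cring : CommutativeRing c ℓ
  open CommutativeRing cring public
  open Poly cring public
  field
    char0   : ∀ n → ¬ (natC (suc n) ≈ 0#)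
    inverse : ∀ x → ¬ (x ≈ 0#) → ∃ λ y → x * y ≈ 1#
    -- every monic polynomial of degree ≥ 1 has a root
    closed  : ∀ (a : Carrier) (as : List Carrier) → ∃ λ z → eval ((a ∷ as) ∷ʳ 1#) z ≈ 0#

module _ {c ℓ : Level} (K : ACF₀ c ℓ) where
  open ACF₀ K
  pk : ℕ → Carrier → Carrier
  pk k z = (((- 1#) + natC 3 * z) - pow z 2) - pow z (suc k)

-- If a is a multiple root of p = -1 + 3z - z² - z^(m+2), then p(a) = p′(a) = 0, and eliminating
-- between the two shows that y = m a is a root of y² - 3(m+1) y + m(m+2) with y^(m+2) = m^m (2m - 3y).
-- Reducing y^(m+2) modulo the quadratic turns the second relation into C + D y = 0 with C, D integers.
-- If D = 0, the conjugate root 3(m+1) - y satisfies the same relation, and multiplying the two relations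
-- equates a positive integer with 0. Otherwise y is rational; a negative y is impossible since all
-- coefficients then have one sign, and for y = e / s ≥ 0 the two relations, cleared of denominators,
-- force e < m s, then 5e < 3m s, and finally 16 · 5^(m+2) < 25 (m+1) 3^(m+2), which is false.
-- That p′(a) = 0 is read off a factorisation p ≈ (z - a)² q as follows: with p(z) - p(a) = (z - a) D(z),
-- the polynomial D - (z - a) q vanishes away from a, hence at infinitely many points, hence at a.

module Submission where

open import Level using (Level)
open import Data.Nat using (ℕ; _≤_)
open import Data.Nat as ℕ using (zero; suc; NonZero)
import Data.Nat.Properties as ℕ
open import Data.Integer as ℤ using (ℤ; +_; -[1+_])
import Data.Integer.Properties as ℤ
open import Data.Sign as Sign using ()
open import Data.Maybe using (Maybe; just; nothing)
open import Data.Product using (∃; _,_; _×_; proj₁; proj₂)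
open import Data.List using (List; []; _∷_; length; map)
open import Data.Empty using (⊥; ⊥-elim)
open import Relation.Nullary using (¬_; yes; no)
open import Relation.Binary.PropositionalEquality as ≡ using (_≡_; _≢_)
open import Function.Definitions using (Injective)
open import Algebra.Bundles using (CommutativeRing)
open import Algebra.Solver.Ring.AlmostCommutativeRing using (fromCommutativeRing; _-Raw-AlmostCommutative⟶_)
open import Defs

module NatBounds where
  open import Data.Nat
  open import Data.Nat.Properties
  open import Data.Nat.Tactic.RingSolver using (solve-∀)
  open import Relation.Binary.PropositionalEquality

  ^-distribʳ-* : ∀ x y n → (x * y) ^ n ≡ x ^ n * y ^ n
  ^-distribʳ-* x y zero    = refl
  ^-distribʳ-* x y (suc n) = trans (cong (x * y *_) (^-distribʳ-* x y n)) (regroup x y (x ^ n) (y ^ n))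
    where
    regroup : ∀ x y a b → x * y * (a * b) ≡ x * a * (y * b)
    regroup = solve-∀

  25*[1+m]*3^[2+m]≤16*5^[2+m] : ∀ m .{{_ : NonZero m}} → 25 * (1 + m) * 3 ^ (2 + m) ≤ 16 * 5 ^ (2 + m)
  25*[1+m]*3^[2+m]≤16*5^[2+m] 1             = m≤m+n 1350 650
  25*[1+m]*3^[2+m]≤16*5^[2+m] (suc (suc m)) = begin
    25 * (3 + m) * 3 ^ (4 + m)           ≡⟨ regroup₁ m (3 ^ (3 + m)) ⟩
    3 * (3 + m) * (25 * 3 ^ (3 + m))     ≤⟨ *-monoˡ-≤ (25 * 3 ^ (3 + m)) 3[3+m]≤5[2+m] ⟩
    5 * (2 + m) * (25 * 3 ^ (3 + m))     ≡⟨ regroup₂ m (3 ^ (3 + m)) ⟩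
    5 * (25 * (2 + m) * 3 ^ (3 + m))     ≤⟨ *-monoʳ-≤ 5 (25*[1+m]*3^[2+m]≤16*5^[2+m] (suc m)) ⟩
    5 * (16 * 5 ^ (3 + m))               ≡⟨ regroup₃ (5 ^ (3 + m)) ⟩
    16 * 5 ^ (4 + m)                     ∎
    where
    open ≤-Reasoning
    regroup₁ : ∀ m t → 25 * (3 + m) * (3 * t) ≡ 3 * (3 + m) * (25 * t)
    regroup₁ = solve-∀
    regroup₂ : ∀ m t → 5 * (2 + m) * (25 * t) ≡ 5 * (25 * (2 + m) * t)
    regroup₂ = solve-∀
    regroup₃ : ∀ t → 5 * (16 * t) ≡ 16 * (5 * t)
    regroup₃ = solve-∀
    3[3+m]≤5[2+m] : 3 * (3 + m) ≤ 5 * (2 + m)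
    3[3+m]≤5[2+m] = subst (3 * (3 + m) ≤_) (slack m) (m≤m+n _ (1 + 2 * m))
      where
      slack : ∀ m → 3 * (3 + m) + (1 + 2 * m) ≡ 5 * (2 + m)
      slack = solve-∀

  module _ {m e s : ℕ} .{{_ : NonZero m}} .{{_ : NonZero s}}
    (quadratic : e * e + m * (2 + m) * (s * s) ≡ 3 * (1 + m) * e * s)
    (power : (1 + m) * e ^ (2 + m) + m ^ m * (e * e) * s ^ m ≡ m ^ m * (m * m) * s ^ (2 + m))
    where

    private
      n = 2 + m
      M = m ^ m
      W = M * (m * m) * s ^ n

    e>0 : 0 < e
    e>0 = n≢0⇒n>0 λ e≡0 → <⇒≢ m[2+m]s²>0 (sym (begin-equality
      0 + m * (2 + m) * (s * s)               ≡⟨ subst (λ x → x * x + _ ≡ 3 * (1 + m) * x * s) e≡0 quadratic ⟩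
      3 * (1 + m) * 0 * s                     ≡⟨ cong (_* s) (*-zeroʳ (3 * (1 + m))) ⟩
      0                                       ∎))
      where
      open ≤-Reasoning
      m[2+m]s²>0 : 0 < m * (2 + m) * (s * s)
      m[2+m]s²>0 = *-mono-< (*-mono-< (>-nonZero⁻¹ m) z<s) (*-mono-< (>-nonZero⁻¹ s) (>-nonZero⁻¹ s))

    e<ms : e < m * s
    e<ms = ≰⇒> λ ms≤e → <-irrefl refl (begin-strict
      W                                          ≡⟨ regroup m s M (s ^ m) ⟩
      0 + M * ((m * s) * (m * s)) * s ^ m         <⟨ +-monoˡ-< _ [1+m]eⁿ>0 ⟩
      (1 + m) * e ^ n + M * ((m * s) * (m * s)) * s ^ m
        ≤⟨ +-monoʳ-≤ ((1 + m) * e ^ n) (*-monoˡ-≤ (s ^ m) (*-monoʳ-≤ M (*-mono-≤ ms≤e ms≤e))) ⟩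
      (1 + m) * e ^ n + M * (e * e) * s ^ m      ≡⟨ power ⟩
      W                                          ∎)
      where
      open ≤-Reasoning
      regroup : ∀ m s M S → M * (m * m) * (s * (s * S)) ≡ 0 + M * ((m * s) * (m * s)) * S
      regroup = solve-∀
      [1+m]eⁿ>0 : 0 < (1 + m) * e ^ n
      [1+m]eⁿ>0 = *-mono-< (z<s {m}) (m^n>0 e {{>-nonZero e>0}} n)

    5e<3ms : 5 * e < 3 * m * s
    5e<3ms = ≰⇒> λ 3ms≤5e → <⇒≱ (m<1 3ms≤5e) (>-nonZero⁻¹ m)
      where
      open ≤-Reasoning
      [10m+15]es<5m[2+m]s² : (10 * m + 15) * (e * s) < 5 * (m * (2 + m) * (s * s))
      [10m+15]es<5m[2+m]s² = +-cancelˡ-< (5 * (m * s * e)) _ _ (begin-strict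
        5 * (m * s * e) + (10 * m + 15) * (e * s) ≡⟨ regroup m e s ⟩
        5 * (3 * (1 + m) * e * s)                 ≡⟨ cong (5 *_) quadratic ⟨
        5 * (e * e + m * (2 + m) * (s * s))       ≡⟨ *-distribˡ-+ 5 (e * e) _ ⟩
        5 * (e * e) + 5 * (m * (2 + m) * (s * s)) <⟨ +-monoˡ-< _ (*-monoʳ-< 5 (*-monoˡ-< e {{>-nonZero e>0}} e<ms)) ⟩
        5 * (m * s * e) + 5 * (m * (2 + m) * (s * s)) ∎)
        where
        regroup : ∀ m e s → 5 * (m * s * e) + (10 * m + 15) * (e * s) ≡ 5 * (3 * (1 + m) * e * s)
        regroup = solve-∀
      m<1 : 3 * m * s ≤ 5 * e → m < 1
      m<1 3ms≤5e = +-cancelˡ-< (5 * m + 9) m 1 (subst₂ _<_ (lhs m) (rhs m) (*-cancelʳ-< (m * (s * s)) _ _ (begin-strict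
        (6 * m + 9) * (m * (s * s))   ≡⟨ regroup₁ m s ⟩
        (2 * m + 3) * (3 * m * s) * s ≤⟨ *-monoˡ-≤ s (*-monoʳ-≤ (2 * m + 3) 3ms≤5e) ⟩
        (2 * m + 3) * (5 * e) * s     ≡⟨ regroup₂ m e s ⟩
        (10 * m + 15) * (e * s)       <⟨ [10m+15]es<5m[2+m]s² ⟩
        5 * (m * (2 + m) * (s * s))   ≡⟨ regroup₃ m s ⟩
        (5 * m + 10) * (m * (s * s))  ∎)))
        where
        regroup₁ : ∀ m s → (6 * m + 9) * (m * (s * s)) ≡ (2 * m + 3) * (3 * m * s) * s
        regroup₁ = solve-∀
        regroup₂ : ∀ m e s → (2 * m + 3) * (5 * e) * s ≡ (10 * m + 15) * (e * s)
        regroup₂ = solve-∀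
        regroup₃ : ∀ m s → 5 * (m * (2 + m) * (s * s)) ≡ (5 * m + 10) * (m * (s * s))
        regroup₃ = solve-∀
        lhs : ∀ m → 6 * m + 9 ≡ (5 * m + 9) + m
        lhs = solve-∀
        rhs : ∀ m → 5 * m + 10 ≡ (5 * m + 9) + 1
        rhs = solve-∀

    quadratic-power-absurd : ⊥
    quadratic-power-absurd = <⇒≱ (*-cancelʳ-< W _ _ (+-cancelʳ-< _ _ _ 16·5ⁿW+9·5ⁿW<25[1+m]3ⁿW+9·5ⁿW))
                                 (25*[1+m]*3^[2+m]≤16*5^[2+m] m)
      where
      open ≤-Reasoning
      regroup₁ : ∀ P W → 16 * P * W + 9 * P * W ≡ 25 * P * W
      regroup₁ = solve-∀
      regroup₂ : ∀ m e P E M S → 25 * P * ((1 + m) * E + M * (e * e) * S)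
                                 ≡ 25 * (1 + m) * (P * E) + P * M * ((5 * e) * (5 * e)) * S
      regroup₂ = solve-∀
      regroup₃ : ∀ m s P₃ P₅ M S →
        25 * (1 + m) * (P₃ * (m * (m * M)) * (s * (s * S))) + P₅ * M * ((3 * m * s) * (3 * m * s)) * S
          ≡ 25 * (1 + m) * P₃ * (M * (m * m) * (s * (s * S))) + 9 * P₅ * (M * (m * m) * (s * (s * S)))
      regroup₃ = solve-∀
      [3ms]ⁿ : (3 * m * s) ^ n ≡ 3 ^ n * (m * (m * M)) * (s * (s * s ^ m))
      [3ms]ⁿ = trans (^-distribʳ-* (3 * m) s n) (cong (_* (s * (s * s ^ m))) (^-distribʳ-* 3 m n))
      16·5ⁿW+9·5ⁿW<25[1+m]3ⁿW+9·5ⁿW : 16 * 5 ^ n * W + 9 * 5 ^ n * W < 25 * (1 + m) * 3 ^ n * W + 9 * 5 ^ n * W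
      16·5ⁿW+9·5ⁿW<25[1+m]3ⁿW+9·5ⁿW = begin-strict
        16 * 5 ^ n * W + 9 * 5 ^ n * W                                    ≡⟨ regroup₁ (5 ^ n) W ⟩
        25 * 5 ^ n * W                                                    ≡⟨ cong (25 * 5 ^ n *_) power ⟨
        25 * 5 ^ n * ((1 + m) * e ^ n + M * (e * e) * s ^ m)              ≡⟨ regroup₂ m e (5 ^ n) (e ^ n) M (s ^ m) ⟩
        25 * (1 + m) * (5 ^ n * e ^ n) + 5 ^ n * M * ((5 * e) * (5 * e)) * s ^ m
          ≡⟨ cong (λ x → 25 * (1 + m) * x + 5 ^ n * M * ((5 * e) * (5 * e)) * s ^ m) (^-distribʳ-* 5 e n) ⟨
        25 * (1 + m) * (5 * e) ^ n + 5 ^ n * M * ((5 * e) * (5 * e)) * s ^ m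
          <⟨ +-mono-<-≤ (*-monoʳ-< (25 * (1 + m)) (^-monoˡ-< n 5e<3ms))
                        (*-monoˡ-≤ (s ^ m) (*-monoʳ-≤ (5 ^ n * M) (*-mono-≤ (<⇒≤ 5e<3ms) (<⇒≤ 5e<3ms)))) ⟩
        25 * (1 + m) * (3 * m * s) ^ n + 5 ^ n * M * ((3 * m * s) * (3 * m * s)) * s ^ m
          ≡⟨ cong (λ x → 25 * (1 + m) * x + 5 ^ n * M * ((3 * m * s) * (3 * m * s)) * s ^ m) [3ms]ⁿ ⟩
        25 * (1 + m) * (3 ^ n * (m * (m * M)) * (s * (s * s ^ m))) + 5 ^ n * M * ((3 * m * s) * (3 * m * s)) * s ^ m
          ≡⟨ regroup₃ m s (3 ^ n) (5 ^ n) M (s ^ m) ⟩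
        25 * (1 + m) * 3 ^ n * W + 9 * 5 ^ n * W                          ∎

module IntegerCoefficients {c ℓ : Level} (R : CommutativeRing c ℓ) where
  open CommutativeRing R
  open Poly R
  open import Algebra.Properties.Ring ring using (-‿distribˡ-*; -‿distribʳ-*; -0#≈0#; -‿+-comm; -‿involutive)
  import Algebra.Properties.Semiring.Mult.TCOptimised semiring as Mult
  open Mult using (×-homo-+; ×1-homo-*; 1+×; ×ᵤ≈×)
  open import Relation.Binary.Reasoning.Setoid setoid

  -- The optimised multiple (1 × x = x) makes the solver's constant con (+ 1) definitionally 1#.
  fromℕ : ℕ → Carrier
  fromℕ n = n Mult.× 1#

  natC≈fromℕ : ∀ n → natC n ≈ fromℕ n
  natC≈fromℕ n = trans (reflexive (natC≡ n)) (×ᵤ≈× n 1#)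
    where
    open import Algebra.Definitions.RawMonoid +-rawMonoid using () renaming (_×_ to _×ᵤ_)
    natC≡ : ∀ n → natC n ≡ n ×ᵤ 1#
    natC≡ zero    = ≡.refl
    natC≡ (suc n) = ≡.cong (_+_ 1#) (natC≡ n)

  fromℕ-+ : ∀ m n → fromℕ (m ℕ.+ n) ≈ fromℕ m + fromℕ n
  fromℕ-+ = ×-homo-+ 1#

  fromℕ-* : ∀ m n → fromℕ (m ℕ.* n) ≈ fromℕ m * fromℕ n
  fromℕ-* = ×1-homo-*

  pow-cong : ∀ {x y} n → x ≈ y → pow x n ≈ pow y n
  pow-cong zero    x≈y = refl
  pow-cong (suc n) x≈y = *-cong x≈y (pow-cong n x≈y)

  pow-distrib-* : ∀ x y n → pow (x * y) n ≈ pow x n * pow y n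
  pow-distrib-* x y zero    = sym (*-identityˡ 1#)
  pow-distrib-* x y (suc n) = begin
    (x * y) * pow (x * y) n       ≈⟨ *-congˡ (pow-distrib-* x y n) ⟩
    (x * y) * (pow x n * pow y n) ≈⟨ *-assoc x y _ ⟩
    x * (y * (pow x n * pow y n)) ≈⟨ *-congˡ (x∙yz≈y∙xz y (pow x n) (pow y n)) ⟩
    x * (pow x n * (y * pow y n)) ≈⟨ *-assoc x (pow x n) _ ⟨
    (x * pow x n) * (y * pow y n) ∎
    where open import Algebra.Properties.CommutativeSemigroup *-commutativeSemigroup using (x∙yz≈y∙xz)

  fromℕ-^ : ∀ m n → fromℕ (m ℕ.^ n) ≈ pow (fromℕ m) n
  fromℕ-^ m zero    = refl
  fromℕ-^ m (suc n) = trans (fromℕ-* m (m ℕ.^ n)) (*-congˡ (fromℕ-^ m n))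

  ι : ℤ → Carrier
  ι (+ n)    = fromℕ n
  ι -[1+ n ] = - fromℕ (suc n)

  ι-⊖ : ∀ m n → ι (m ℤ.⊖ n) ≈ fromℕ m - fromℕ n
  ι-⊖ zero    zero    = sym (-‿inverseʳ 0#)
  ι-⊖ zero    (suc n) = sym (+-identityˡ _)
  ι-⊖ (suc m) zero    = sym (trans (+-congˡ -0#≈0#) (+-identityʳ _))
  ι-⊖ (suc m) (suc n) = begin
    ι (suc m ℤ.⊖ suc n)               ≡⟨ ≡.cong ι (ℤ.[1+m]⊖[1+n]≡m⊖n m n) ⟩
    ι (m ℤ.⊖ n)                       ≈⟨ ι-⊖ m n ⟩
    fromℕ m - fromℕ n                 ≈⟨ +-identityˡ _ ⟨
    0# + (fromℕ m - fromℕ n)          ≈⟨ +-congʳ (-‿inverseʳ 1#) ⟨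
    (1# - 1#) + (fromℕ m - fromℕ n)   ≈⟨ interchange 1# (fromℕ m) (- 1#) (- fromℕ n) ⟨
    (1# + fromℕ m) + (- 1# - fromℕ n) ≈⟨ +-congˡ (-‿+-comm 1# (fromℕ n)) ⟩
    (1# + fromℕ m) - (1# + fromℕ n)   ≈⟨ +-cong (1+× m 1#) (-‿cong (1+× n 1#)) ⟨
    fromℕ (suc m) - fromℕ (suc n)     ∎
    where open import Algebra.Properties.CommutativeSemigroup +-commutativeSemigroup using (interchange)

  ι-+ : ∀ i j → ι (i ℤ.+ j) ≈ ι i + ι j
  ι-+ (+ m)    (+ n)    = fromℕ-+ m n
  ι-+ (+ m)    -[1+ n ] = ι-⊖ m (suc n)
  ι-+ -[1+ m ] (+ n)    = trans (ι-⊖ n (suc m)) (+-comm _ _)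
  ι-+ -[1+ m ] -[1+ n ] = begin
    - fromℕ (suc (suc (m ℕ.+ n)))       ≡⟨ ≡.cong (λ k → - fromℕ (suc k)) (ℕ.+-suc m n) ⟨
    - fromℕ (suc m ℕ.+ suc n)           ≈⟨ -‿cong (fromℕ-+ (suc m) (suc n)) ⟩
    - (fromℕ (suc m) + fromℕ (suc n))   ≈⟨ -‿+-comm _ _ ⟨
    - fromℕ (suc m) - fromℕ (suc n)     ∎

  ι-‿ : ∀ i → ι (ℤ.- i) ≈ - ι i
  ι-‿ (+ zero)  = sym -0#≈0#
  ι-‿ (+ suc n) = refl
  ι-‿ -[1+ n ]  = sym (-‿involutive _)

  ι-◃⁺ : ∀ n → ι (Sign.+ ℤ.◃ n) ≈ fromℕ n
  ι-◃⁺ zero    = refl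
  ι-◃⁺ (suc n) = refl

  ι-◃⁻ : ∀ n → ι (Sign.- ℤ.◃ n) ≈ - fromℕ n
  ι-◃⁻ zero    = sym -0#≈0#
  ι-◃⁻ (suc n) = refl

  ι-* : ∀ i j → ι (i ℤ.* j) ≈ ι i * ι j
  ι-* (+ m)    (+ n)    = trans (ι-◃⁺ (m ℕ.* n)) (fromℕ-* m n)
  ι-* (+ m)    -[1+ n ] = trans (ι-◃⁻ (m ℕ.* suc n)) (trans (-‿cong (fromℕ-* m (suc n))) (-‿distribʳ-* _ _))
  ι-* -[1+ m ] (+ n)    = trans (ι-◃⁻ (suc m ℕ.* n)) (trans (-‿cong (fromℕ-* (suc m) n)) (-‿distribˡ-* _ _))
  ι-* -[1+ m ] -[1+ n ] = begin
    ι (Sign.+ ℤ.◃ (suc m ℕ.* suc n))  ≈⟨ ι-◃⁺ (suc m ℕ.* suc n) ⟩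
    fromℕ (suc m ℕ.* suc n)           ≈⟨ fromℕ-* (suc m) (suc n) ⟩
    x * y                             ≈⟨ -‿involutive _ ⟨
    - - (x * y)                       ≈⟨ -‿cong (-‿distribʳ-* x y) ⟩
    - (x * - y)                       ≈⟨ -‿distribˡ-* x (- y) ⟩
    - x * - y                         ∎
    where
    x = fromℕ (suc m)
    y = fromℕ (suc n)

  ι-homomorphism : ℤ.+-*-rawRing -Raw-AlmostCommutative⟶ fromCommutativeRing R
  ι-homomorphism = record
    { ⟦_⟧    = ι
    ; +-homo = ι-+
    ; *-homo = ι-*
    ; -‿homo = ι-‿
    ; 0-homo = refl
    ; 1-homo = refl
    }

  ι-≟ : ∀ i j → Maybe (ι i ≈ ι j)
  ι-≟ i j with i ℤ.≟ j
  ... | yes ≡.refl = just refl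
  ... | no _       = nothing

  open import Algebra.Solver.Ring ℤ.+-*-rawRing (fromCommutativeRing R) ι-homomorphism ι-≟ public
    using (solve; _:=_; _:+_; _:*_; :-_; _:-_; con)

  IsInteger : Carrier → Set ℓ
  IsInteger x = ∃ λ (i : ℤ) → x ≈ ι i

  fromℕ-isInteger : ∀ n → IsInteger (fromℕ n)
  fromℕ-isInteger n = + n , refl

  +-isInteger : ∀ {x y} → IsInteger x → IsInteger y → IsInteger (x + y)
  +-isInteger (i , x≈i) (j , y≈j) = i ℤ.+ j , trans (+-cong x≈i y≈j) (sym (ι-+ i j))

  -‿isInteger : ∀ {x} → IsInteger x → IsInteger (- x)
  -‿isInteger (i , x≈i) = ℤ.- i , trans (-‿cong x≈i) (sym (ι-‿ i))

  *-isInteger : ∀ {x y} → IsInteger x → IsInteger y → IsInteger (x * y)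
  *-isInteger (i , x≈i) (j , y≈j) = i ℤ.* j , trans (*-cong x≈i y≈j) (sym (ι-* i j))

  pow-isInteger : ∀ {x} n → IsInteger x → IsInteger (pow x n)
  pow-isInteger zero    _     = fromℕ-isInteger 1
  pow-isInteger (suc n) x-int = *-isInteger x-int (pow-isInteger n x-int)

  powMod : Carrier → Carrier → ℕ → Carrier × Carrier
  powMod u v zero    = 1# , 0#
  powMod u v (suc n) = v * B , A + u * B
    where
    A = proj₁ (powMod u v n)
    B = proj₂ (powMod u v n)

  pow≈powMod : ∀ {u v x} n → x * x ≈ u * x + v →
               pow x n ≈ proj₁ (powMod u v n) + proj₂ (powMod u v n) * x
  pow≈powMod {x = x} zero    _       = solve 1 (λ x → con (+ 1) := con (+ 1) :+ con (+ 0) :* x) refl x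
  pow≈powMod {u} {v} {x} (suc n) x²≈ux+v = begin
    x * pow x n               ≈⟨ *-congˡ (pow≈powMod n x²≈ux+v) ⟩
    x * (A + B * x)           ≈⟨ solve 3 (λ x a b → x :* (a :+ b :* x) := a :* x :+ b :* (x :* x)) refl x A B ⟩
    A * x + B * (x * x)       ≈⟨ +-congˡ (*-congˡ x²≈ux+v) ⟩
    A * x + B * (u * x + v)   ≈⟨ solve 5 (λ x a b u v → a :* x :+ b :* (u :* x :+ v) := v :* b :+ (a :+ u :* b) :* x) refl x A B u v ⟩
    v * B + (A + u * B) * x   ∎
    where
    A = proj₁ (powMod u v n)
    B = proj₂ (powMod u v n)

  powMod-isInteger : ∀ {u v} n → IsInteger u → IsInteger v →
                     IsInteger (proj₁ (powMod u v n)) × IsInteger (proj₂ (powMod u v n))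
  powMod-isInteger zero    _     _     = fromℕ-isInteger 1 , fromℕ-isInteger 0
  powMod-isInteger (suc n) u-int v-int =
    *-isInteger v-int B-int , +-isInteger A-int (*-isInteger u-int B-int)
    where
    A-int = proj₁ (powMod-isInteger n u-int v-int)
    B-int = proj₂ (powMod-isInteger n u-int v-int)

module CoefficientLists {c ℓ : Level} (R : CommutativeRing c ℓ) where
  open CommutativeRing R
  open Poly R
  open IntegerCoefficients R using (fromℕ; solve; _:=_; _:+_; _:*_; :-_; _:-_; con)
  open import Relation.Binary.Reasoning.Setoid setoid

  infixl 6 _⊕_
  _⊕_ : List Carrier → List Carrier → List Carrier
  []      ⊕ g       = g
  (a ∷ f) ⊕ []      = a ∷ f
  (a ∷ f) ⊕ (b ∷ g) = (a + b) ∷ (f ⊕ g)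

  eval-⊕ : ∀ f g z → eval (f ⊕ g) z ≈ eval f z + eval g z
  eval-⊕ []      g       z = sym (+-identityˡ _)
  eval-⊕ (a ∷ f) []      z = sym (+-identityʳ _)
  eval-⊕ (a ∷ f) (b ∷ g) z = begin
    (a + b) + z * eval (f ⊕ g) z               ≈⟨ +-congˡ (*-congˡ (eval-⊕ f g z)) ⟩
    (a + b) + z * (eval f z + eval g z)        ≈⟨ solve 5 (λ a b z F G → (a :+ b) :+ z :* (F :+ G) := (a :+ z :* F) :+ (b :+ z :* G)) refl a b z (eval f z) (eval g z) ⟩
    (a + z * eval f z) + (b + z * eval g z)    ∎

  scale : Carrier → List Carrier → List Carrier
  scale k = map (k *_)

  eval-scale : ∀ k f z → eval (scale k f) z ≈ k * eval f z
  eval-scale k []      z = sym (zeroʳ k)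
  eval-scale k (a ∷ f) z = begin
    k * a + z * eval (scale k f) z  ≈⟨ +-congˡ (*-congˡ (eval-scale k f z)) ⟩
    k * a + z * (k * eval f z)      ≈⟨ solve 4 (λ k a z F → k :* a :+ z :* (k :* F) := k :* (a :+ z :* F)) refl k a z (eval f z) ⟩
    k * (a + z * eval f z)          ∎

  X-_*_ : Carrier → List Carrier → List Carrier
  X- a * q = (0# ∷ q) ⊕ scale (- a) q

  eval-X-* : ∀ a q z → eval (X- a * q) z ≈ (z - a) * eval q z
  eval-X-* a q z = begin
    eval ((0# ∷ q) ⊕ scale (- a) q) z              ≈⟨ eval-⊕ (0# ∷ q) (scale (- a) q) z ⟩
    (0# + z * eval q z) + eval (scale (- a) q) z   ≈⟨ +-congˡ (eval-scale (- a) q z) ⟩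
    (0# + z * eval q z) + - a * eval q z           ≈⟨ solve 3 (λ z a Q → (con (+ 0) :+ z :* Q) :+ (:- a) :* Q := (z :- a) :* Q) refl z a (eval q z) ⟩
    (z - a) * eval q z                             ∎

  quotient : List Carrier → Carrier → List Carrier
  quotient []          x = []
  quotient (a ∷ [])    x = []
  quotient (a ∷ b ∷ f) x = eval (b ∷ f) x ∷ quotient (b ∷ f) x

  length-quotient : ∀ a f x → length (quotient (a ∷ f) x) ≡ length f
  length-quotient a []      x = ≡.refl
  length-quotient a (b ∷ f) x = ≡.cong suc (length-quotient b f x)

  eval-quotient : ∀ f x z → eval f z ≈ eval f x + (z - x) * eval (quotient f x) z
  eval-quotient []          x z = solve 2 (λ z x → con (+ 0) := con (+ 0) :+ (z :- x) :* con (+ 0)) refl z x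
  eval-quotient (a ∷ [])    x z = solve 3 (λ a z x → a :+ z :* con (+ 0) := (a :+ x :* con (+ 0)) :+ (z :- x) :* con (+ 0)) refl a z x
  eval-quotient (a ∷ b ∷ f) x z = begin
    a + z * G z                     ≈⟨ +-congˡ (*-congˡ (eval-quotient (b ∷ f) x z)) ⟩
    a + z * (G x + (z - x) * H z)   ≈⟨ solve 5 (λ a z x Gx Hz → a :+ z :* (Gx :+ (z :- x) :* Hz) := (a :+ x :* Gx) :+ (z :- x) :* (Gx :+ z :* Hz)) refl a z x (G x) (H z) ⟩
    (a + x * G x) + (z - x) * (G x + z * H z) ∎
    where
    G = eval (b ∷ f)
    H = eval (quotient (b ∷ f) x)

  geometric : Carrier → ℕ → List Carrier
  geometric a zero    = 1# ∷ []
  geometric a (suc n) = pow a (suc n) ∷ geometric a n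

  pow-pow≈X-*geometric : ∀ a n z → pow z (suc n) - pow a (suc n) ≈ (z - a) * eval (geometric a n) z
  pow-pow≈X-*geometric a zero    z = solve 2 (λ z a → z :* con (+ 1) :- a :* con (+ 1) := (z :- a) :* (con (+ 1) :+ z :* con (+ 0))) refl z a
  pow-pow≈X-*geometric a (suc n) z = begin
    z * pow z (suc n) - a * pow a (suc n)                 ≈⟨ solve 4 (λ z a Z A → z :* Z :- a :* A := z :* (Z :- A) :+ (z :- a) :* A) refl z a (pow z (suc n)) (pow a (suc n)) ⟩
    z * (pow z (suc n) - pow a (suc n)) + (z - a) * pow a (suc n)
                                                          ≈⟨ +-congʳ (*-congˡ (pow-pow≈X-*geometric a n z)) ⟩
    z * ((z - a) * S) + (z - a) * pow a (suc n)           ≈⟨ solve 4 (λ z a S A → z :* ((z :- a) :* S) :+ (z :- a) :* A := (z :- a) :* (A :+ z :* S)) refl z a S (pow a (suc n)) ⟩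
    (z - a) * (pow a (suc n) + z * S)                     ∎
    where
    S = eval (geometric a n) z

  eval-geometric-at : ∀ a n → eval (geometric a n) a ≈ fromℕ (suc n) * pow a n
  eval-geometric-at a zero    = solve 1 (λ a → con (+ 1) :+ a :* con (+ 0) := con (+ 1) :* con (+ 1)) refl a
  eval-geometric-at a (suc n) = begin
    a * pow a n + a * eval (geometric a n) a     ≈⟨ +-congˡ (*-congˡ (eval-geometric-at a n)) ⟩
    a * pow a n + a * (fromℕ (suc n) * pow a n)  ≈⟨ solve 3 (λ a N P → a :* P :+ a :* (N :* P) := (N :+ con (+ 1)) :* (a :* P)) refl a (fromℕ (suc n)) (pow a n) ⟩
    (fromℕ (suc n) + 1#) * (a * pow a n)         ∎

module CharacteristicZero {c ℓ : Level} (K : ACF₀ c ℓ) where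
  open ACF₀ K
  open IntegerCoefficients cring
  open CoefficientLists cring
  open import Algebra.Properties.Group +-group using (∙-cancelˡ; x∙y⁻¹≈ε⇒x≈y; x≈y⇒x∙y⁻¹≈ε; inverseˡ-unique; inverseʳ-unique)
  open import Algebra.Properties.Ring ring using (-0#≈0#)
  open import Relation.Binary.Reasoning.Setoid setoid

  fromℕ-suc≉0 : ∀ n → ¬ fromℕ (suc n) ≈ 0#
  fromℕ-suc≉0 n eq = char0 n (trans (natC≈fromℕ (suc n)) eq)

  fromℕ-injective : ∀ {m n} → fromℕ m ≈ fromℕ n → m ≡ n
  fromℕ-injective {zero}  {zero}  _  = ≡.refl
  fromℕ-injective {zero}  {suc n} eq = ⊥-elim (fromℕ-suc≉0 n (sym eq))
  fromℕ-injective {suc m} {zero}  eq = ⊥-elim (fromℕ-suc≉0 m eq)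
  fromℕ-injective {suc m} {suc n} eq = ≡.cong suc (fromℕ-injective (∙-cancelˡ 1# _ _ (begin
    1# + fromℕ m     ≈⟨ 1+× m 1# ⟨
    fromℕ (suc m)    ≈⟨ eq ⟩
    fromℕ (suc n)    ≈⟨ 1+× n 1# ⟩
    1# + fromℕ n     ∎)))
    where open import Algebra.Properties.Semiring.Mult.TCOptimised semiring using (1+×)

  *-cancelˡ-≈0 : ∀ {x y} → ¬ x ≈ 0# → x * y ≈ 0# → y ≈ 0#
  *-cancelˡ-≈0 {x} {y} x≉0 xy≈0 with inverse x x≉0
  ... | x⁻¹ , xx⁻¹≈1 = begin
    y               ≈⟨ *-identityˡ y ⟨
    1# * y          ≈⟨ *-congʳ (trans (sym xx⁻¹≈1) (*-comm x x⁻¹)) ⟩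
    (x⁻¹ * x) * y   ≈⟨ *-assoc x⁻¹ x y ⟩
    x⁻¹ * (x * y)   ≈⟨ *-congˡ xy≈0 ⟩
    x⁻¹ * 0#        ≈⟨ zeroʳ x⁻¹ ⟩
    0#              ∎

  eval≈0-everywhere : ∀ n f (xs : ℕ → Carrier) → length f ℕ.≤ n → Injective _≡_ _≈_ xs →
                      (∀ i → eval f (xs i) ≈ 0#) → ∀ z → eval f z ≈ 0#
  eval≈0-everywhere n       []      xs _         _      _       z = refl
  eval≈0-everywhere (suc n) (a ∷ f) xs (ℕ.s≤s ≤n) xs-inj f[xs]≈0 z = begin
    eval (a ∷ f) z                              ≈⟨ eval-quotient (a ∷ f) (xs 0) z ⟩
    eval (a ∷ f) (xs 0) + (z - xs 0) * eval h z ≈⟨ +-cong (f[xs]≈0 0) (*-congˡ (h≈0 z)) ⟩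
    0# + (z - xs 0) * 0#                        ≈⟨ trans (+-identityˡ _) (zeroʳ _) ⟩
    0#                                          ∎
    where
    h = quotient (a ∷ f) (xs 0)
    h[xs∘suc]≈0 : ∀ i → eval h (xs (suc i)) ≈ 0#
    h[xs∘suc]≈0 i = *-cancelˡ-≈0 (λ eq → ℕ.1+n≢0 (xs-inj (x∙y⁻¹≈ε⇒x≈y _ _ eq))) (begin
      (xs (suc i) - xs 0) * eval h (xs (suc i))                          ≈⟨ +-identityˡ _ ⟨
      0# + (xs (suc i) - xs 0) * eval h (xs (suc i))                     ≈⟨ +-congʳ (f[xs]≈0 0) ⟨
      eval (a ∷ f) (xs 0) + (xs (suc i) - xs 0) * eval h (xs (suc i))    ≈⟨ eval-quotient (a ∷ f) (xs 0) (xs (suc i)) ⟨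
      eval (a ∷ f) (xs (suc i))                                          ≈⟨ f[xs]≈0 (suc i) ⟩
      0#                                                                 ∎)
    h≈0 : ∀ z → eval h z ≈ 0#
    h≈0 = eval≈0-everywhere n h (λ i → xs (suc i))
            (≡.subst (ℕ._≤ n) (≡.sym (length-quotient a f (xs 0))) ≤n)
            (λ eq → ℕ.suc-injective (xs-inj eq)) h[xs∘suc]≈0

  -- In characteristic 0 the points a + 1, a + 2, … are distinct and differ from a.
  eval≈0-at : ∀ f a → (∀ z → ¬ z ≈ a → eval f z ≈ 0#) → eval f a ≈ 0#
  eval≈0-at f a f≈0-off-a = eval≈0-everywhere (length f) f xs ℕ.≤-refl xs-inj (λ i → f≈0-off-a (xs i) (xs≉a i)) a
    where
    xs : ℕ → Carrier
    xs i = a + fromℕ (suc i)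
    xs-inj : Injective _≡_ _≈_ xs
    xs-inj eq = ℕ.suc-injective (fromℕ-injective (∙-cancelˡ a _ _ eq))
    xs≉a : ∀ i → ¬ xs i ≈ a
    xs≉a i eq = fromℕ-suc≉0 i (∙-cancelˡ a _ _ (trans eq (sym (+-identityʳ a))))

  multipleRoot⇒derivative≈0 : ∀ (p : Carrier → Carrier) a D → (∀ z → p z - p a ≈ (z - a) * eval D z) →
                              IsMultipleRoot p a → p a ≈ 0# × eval D a ≈ 0#
  multipleRoot⇒derivative≈0 p a D p-difference (q , p≈[X-a]²q) = pa≈0 , Da≈0
    where
    pa≈0 : p a ≈ 0#
    pa≈0 = begin
      p a                            ≈⟨ p≈[X-a]²q a ⟩
      ((a - a) * (a - a)) * eval q a ≈⟨ solve 2 (λ a Q → ((a :- a) :* (a :- a)) :* Q := con (+ 0)) refl a (eval q a) ⟩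
      0#                             ∎
    F : List Carrier
    F = D ⊕ scale (- 1#) (X- a * q)
    eval-F : ∀ z → eval F z ≈ eval D z - (z - a) * eval q z
    eval-F z = begin
      eval F z                                     ≈⟨ eval-⊕ D (scale (- 1#) (X- a * q)) z ⟩
      eval D z + eval (scale (- 1#) (X- a * q)) z  ≈⟨ +-congˡ (trans (eval-scale (- 1#) (X- a * q) z) (*-congˡ (eval-X-* a q z))) ⟩
      eval D z + - 1# * ((z - a) * eval q z)       ≈⟨ solve 4 (λ Dz z a Q → Dz :+ (:- con (+ 1)) :* ((z :- a) :* Q) := Dz :- (z :- a) :* Q) refl (eval D z) z a (eval q z) ⟩
      eval D z - (z - a) * eval q z                ∎
    F≈0-off-a : ∀ z → ¬ z ≈ a → eval F z ≈ 0#
    F≈0-off-a z z≉a = *-cancelˡ-≈0 (λ eq → z≉a (x∙y⁻¹≈ε⇒x≈y z a eq)) (begin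
      (z - a) * eval F z                                   ≈⟨ *-congˡ (eval-F z) ⟩
      (z - a) * (eval D z - (z - a) * eval q z)            ≈⟨ solve 4 (λ z a Dz Q → (z :- a) :* (Dz :- (z :- a) :* Q) := (z :- a) :* Dz :- ((z :- a) :* (z :- a)) :* Q) refl z a (eval D z) (eval q z) ⟩
      (z - a) * eval D z - ((z - a) * (z - a)) * eval q z  ≈⟨ +-cong (p-difference z) (-‿cong (p≈[X-a]²q z)) ⟨
      (p z - p a) - p z                                    ≈⟨ solve 2 (λ pz pa → (pz :- pa) :- pz := :- pa) refl (p z) (p a) ⟩
      - p a                                                ≈⟨ -‿cong pa≈0 ⟩
      - 0#                                                 ≈⟨ -0#≈0# ⟩
      0#                                                   ∎)
    Da≈0 : eval D a ≈ 0#
    Da≈0 = begin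
      eval D a                          ≈⟨ solve 3 (λ Da a Q → Da := Da :- (a :- a) :* Q) refl (eval D a) a (eval q a) ⟩
      eval D a - (a - a) * eval q a     ≈⟨ eval-F a ⟨
      eval F a                          ≈⟨ eval≈0-at F a F≈0-off-a ⟩
      0#                                ∎

  pk-quotient : Carrier → ℕ → List Carrier
  pk-quotient a k = (natC 3 - a ∷ - 1# ∷ []) ⊕ scale (- 1#) (geometric a k)

  eval-pk-quotient : ∀ a k z → eval (pk-quotient a k) z ≈ ((natC 3 - a) - z) - eval (geometric a k) z
  eval-pk-quotient a k z = begin
    eval (pk-quotient a k) z                                      ≈⟨ eval-⊕ (natC 3 - a ∷ - 1# ∷ []) (scale (- 1#) (geometric a k)) z ⟩
    ((natC 3 - a) + z * (- 1# + z * 0#)) + eval (scale (- 1#) (geometric a k)) z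
                                                                  ≈⟨ +-congˡ (eval-scale (- 1#) (geometric a k) z) ⟩
    ((natC 3 - a) + z * (- 1# + z * 0#)) + - 1# * S               ≈⟨ solve 4 (λ T a z S → ((T :- a) :+ z :* (:- con (+ 1) :+ z :* con (+ 0))) :+ (:- con (+ 1)) :* S := ((T :- a) :- z) :- S) refl (natC 3) a z S ⟩
    ((natC 3 - a) - z) - S                                        ∎
    where S = eval (geometric a k) z

  pk-difference : ∀ a k z → pk K k z - pk K k a ≈ (z - a) * eval (pk-quotient a k) z
  pk-difference a k z = begin
    pk K k z - pk K k a
      ≈⟨ solve 5 (λ T z a Z A →
             ((((:- con (+ 1)) :+ T :* z) :- z :* (z :* con (+ 1))) :- Z) :- ((((:- con (+ 1)) :+ T :* a) :- a :* (a :* con (+ 1))) :- A)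
           := (z :- a) :* ((T :- a) :- z) :- (Z :- A))
           refl (natC 3) z a (pow z (suc k)) (pow a (suc k)) ⟩
    (z - a) * ((natC 3 - a) - z) - (pow z (suc k) - pow a (suc k))    ≈⟨ +-congˡ (-‿cong (pow-pow≈X-*geometric a k z)) ⟩
    (z - a) * ((natC 3 - a) - z) - (z - a) * S                        ≈⟨ solve 4 (λ T z a S → (z :- a) :* ((T :- a) :- z) :- (z :- a) :* S := (z :- a) :* (((T :- a) :- z) :- S)) refl (natC 3) z a S ⟩
    (z - a) * (((natC 3 - a) - z) - S)                                ≈⟨ *-congˡ (eval-pk-quotient a k z) ⟨
    (z - a) * eval (pk-quotient a k) z                                ∎
    where S = eval (geometric a k) z

  eval-pk-quotient-at : ∀ a k → eval (pk-quotient a k) a ≈ ((natC 3 - a) - a) - fromℕ (suc k) * pow a k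
  eval-pk-quotient-at a k = trans (eval-pk-quotient a k a) (+-congˡ (-‿cong (eval-geometric-at a k)))

  rootSum rootProduct : ℕ → Carrier
  rootSum     m = fromℕ 3 * (1# + fromℕ m)
  rootProduct m = fromℕ m * (fromℕ 2 + fromℕ m)

  Quadratic : ℕ → Carrier → Set ℓ
  Quadratic m y = y * y ≈ rootSum m * y - rootProduct m

  PowerRelation : ℕ → Carrier → Set ℓ
  PowerRelation m y = pow y (2 ℕ.+ m) ≈ pow (fromℕ m) m * (fromℕ 2 * fromℕ m - fromℕ 3 * y)

  -- a p′(a) - (m + 2) p(a) = m a² - 3(m + 1) a + (m + 2) is the quadratic for y = m a up to a factor m, and
  -- y^(m+2) = mᵐ m² a^(m+2) = mᵐ m² (3a - 1 - a²) reduces modulo that quadratic to mᵐ (2m - 3y).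
  scaledRoot-relations : ∀ m a → pk K (suc m) a ≈ 0# → ((natC 3 - a) - a) - fromℕ (2 ℕ.+ m) * pow a (suc m) ≈ 0# →
                         Quadratic m (fromℕ m * a) × PowerRelation m (fromℕ m * a)
  scaledRoot-relations m a p≈0 p′≈0 = quadratic , power
    where
    N = fromℕ m
    A = pow a m
    y = N * a
    p₀ = (((- 1#) + fromℕ 3 * a) - a * (a * 1#)) - a * (a * A)
    p₁ = ((fromℕ 3 - a) - a) - (fromℕ 2 + N) * (a * A)
    p₀≈0 : p₀ ≈ 0#
    p₀≈0 = trans (+-congʳ (+-congʳ (+-congˡ (*-congʳ (sym (natC≈fromℕ 3)))))) p≈0
    p₁≈0 : p₁ ≈ 0#
    p₁≈0 = trans (+-cong (+-congʳ (+-congʳ (sym (natC≈fromℕ 3)))) (-‿cong (*-congʳ (sym (fromℕ-+ 2 m))))) p′≈0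
    quadratic-residue : y * y - (rootSum m * y - rootProduct m) ≈ 0#
    quadratic-residue = begin
      y * y - (rootSum m * y - rootProduct m) ≈⟨ solve 3 (λ N a A →
          (N :* a) :* (N :* a) :- (con (+ 3) :* (con (+ 1) :+ N) :* (N :* a) :- N :* (con (+ 2) :+ N))
        := N :* (a :* (((con (+ 3) :- a) :- a) :- (con (+ 2) :+ N) :* (a :* A))
                 :- (con (+ 2) :+ N) :* ((((:- con (+ 1)) :+ con (+ 3) :* a) :- a :* (a :* con (+ 1))) :- a :* (a :* A))))
        refl N a A ⟩
      N * (a * p₁ - (fromℕ 2 + N) * p₀)       ≈⟨ *-congˡ (+-cong (*-congˡ p₁≈0) (-‿cong (*-congˡ p₀≈0))) ⟩
      N * (a * 0# - (fromℕ 2 + N) * 0#)       ≈⟨ solve 2 (λ N a → N :* (a :* con (+ 0) :- (con (+ 2) :+ N) :* con (+ 0)) := con (+ 0)) refl N a ⟩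
      0#                                      ∎
    quadratic : Quadratic m y
    quadratic = x∙y⁻¹≈ε⇒x≈y _ _ quadratic-residue
    power : PowerRelation m y
    power = x∙y⁻¹≈ε⇒x≈y _ _ (begin
      y * (y * pow y m) - pow N m * (fromℕ 2 * N - fromℕ 3 * y)
        ≈⟨ +-congʳ (*-congˡ (*-congˡ (pow-distrib-* N a m))) ⟩
      y * (y * (pow N m * A)) - pow N m * (fromℕ 2 * N - fromℕ 3 * y)
        ≈⟨ solve 4 (λ N a A Nᵐ →
              (N :* a) :* ((N :* a) :* (Nᵐ :* A)) :- Nᵐ :* (con (+ 2) :* N :- con (+ 3) :* (N :* a))
            := :- Nᵐ :* ((N :* N) :* ((((:- con (+ 1)) :+ con (+ 3) :* a) :- a :* (a :* con (+ 1))) :- a :* (a :* A))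
                        :+ ((N :* a) :* (N :* a) :- (con (+ 3) :* (con (+ 1) :+ N) :* (N :* a) :- N :* (con (+ 2) :+ N)))))
            refl N a A (pow N m) ⟩
      - pow N m * ((N * N) * p₀ + (y * y - (rootSum m * y - rootProduct m)))
        ≈⟨ *-congˡ (+-cong (*-congˡ p₀≈0) quadratic-residue) ⟩
      - pow N m * ((N * N) * 0# + 0#)
        ≈⟨ solve 2 (λ N Nᵐ → :- Nᵐ :* ((N :* N) :* con (+ 0) :+ con (+ 0)) := con (+ 0)) refl N (pow N m) ⟩
      0# ∎)

  module _ (m : ℕ) .{{_ : NonZero m}} {y : Carrier} (quadratic : Quadratic m y) (power : PowerRelation m y) where
    private
      N  = fromℕ m
      Nᵐ = pow N m
      s  = rootSum m
      p  = rootProduct m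
      n  = 2 ℕ.+ m
      A  = proj₁ (powMod s (- p) n)
      B  = proj₂ (powMod s (- p) n)
      C  = A - Nᵐ * (fromℕ 2 * N)
      D  = B + Nᵐ * fromℕ 3

    quadratic-residue≈0 : ∀ {x} → Quadratic m x → x * x - (s * x - p) ≈ 0#
    quadratic-residue≈0 = x≈y⇒x∙y⁻¹≈ε

    power-residue : ∀ {x} → Quadratic m x → pow x n - Nᵐ * (fromℕ 2 * N - fromℕ 3 * x) ≈ C + D * x
    power-residue {x} x-quadratic = begin
      pow x n - Nᵐ * (fromℕ 2 * N - fromℕ 3 * x)        ≈⟨ +-congʳ (pow≈powMod n x-quadratic) ⟩
      (A + B * x) - Nᵐ * (fromℕ 2 * N - fromℕ 3 * x)
        ≈⟨ solve 5 (λ A B x Nᵐ N → (A :+ B :* x) :- Nᵐ :* (con (+ 2) :* N :- con (+ 3) :* x)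
                                 := (A :- Nᵐ :* (con (+ 2) :* N)) :+ (B :+ Nᵐ :* con (+ 3)) :* x) refl A B x Nᵐ N ⟩
      C + D * x                                         ∎

    C+Dy≈0 : C + D * y ≈ 0#
    C+Dy≈0 = trans (sym (power-residue quadratic)) (x≈y⇒x∙y⁻¹≈ε power)

    A-isInteger×B-isInteger : IsInteger A × IsInteger B
    A-isInteger×B-isInteger = powMod-isInteger n s-int (-‿isInteger p-int)
      where
      s-int : IsInteger s
      s-int = *-isInteger (fromℕ-isInteger 3) (+-isInteger (fromℕ-isInteger 1) (fromℕ-isInteger m))
      p-int : IsInteger p
      p-int = *-isInteger (fromℕ-isInteger m) (+-isInteger (fromℕ-isInteger 2) (fromℕ-isInteger m))

    Nᵐ-isInteger : IsInteger Nᵐ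
    Nᵐ-isInteger = pow-isInteger m (fromℕ-isInteger m)

    C-isInteger : IsInteger C
    C-isInteger = +-isInteger (proj₁ A-isInteger×B-isInteger)
                    (-‿isInteger (*-isInteger Nᵐ-isInteger (*-isInteger (fromℕ-isInteger 2) (fromℕ-isInteger m))))

    D-isInteger : IsInteger D
    D-isInteger = +-isInteger (proj₂ A-isInteger×B-isInteger) (*-isInteger Nᵐ-isInteger (fromℕ-isInteger 3))

    irrational-absurd : D ≈ 0# → ⊥
    irrational-absurd D≈0 = ℕ.<⇒≢ X>0 (≡.sym (fromℕ-injective fromℕX≈0))
      where
      y′ = s - y
      f  = fromℕ 2 * N - fromℕ 3 * y
      f′ = fromℕ 2 * N - fromℕ 3 * y′
      r≈0 : y * y - (s * y - p) ≈ 0#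
      r≈0 = quadratic-residue≈0 quadratic
      quadratic′ : Quadratic m y′
      quadratic′ = begin
        y′ * y′                                      ≈⟨ solve 3 (λ s p y → (s :- y) :* (s :- y) := (s :* (s :- y) :- p) :+ (y :* y :- (s :* y :- p))) refl s p y ⟩
        (s * y′ - p) + (y * y - (s * y - p))         ≈⟨ +-congˡ r≈0 ⟩
        (s * y′ - p) + 0#                            ≈⟨ +-identityʳ _ ⟩
        s * y′ - p                                   ∎
      yy′≈p : y * y′ ≈ p
      yy′≈p = begin
        y * y′                                       ≈⟨ solve 3 (λ s p y → y :* (s :- y) := p :- (y :* y :- (s :* y :- p))) refl s p y ⟩
        p - (y * y - (s * y - p))                    ≈⟨ +-congˡ (trans (-‿cong r≈0) -0#≈0#) ⟩
        p + 0#                                       ≈⟨ +-identityʳ p ⟩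
        p                                            ∎
      ff′ : f * f′ ≈ - (fromℕ 5 * (N * N))
      ff′ = begin
        f * f′                                       ≈⟨ solve 2 (λ N y → (con (+ 2) :* N :- con (+ 3) :* y) :* (con (+ 2) :* N :- con (+ 3) :* (con (+ 3) :* (con (+ 1) :+ N) :- y))
                                                                    := :- (con (+ 5) :* (N :* N)) :- con (+ 9) :* (y :* y :- (con (+ 3) :* (con (+ 1) :+ N) :* y :- N :* (con (+ 2) :+ N)))) refl N y ⟩
        - (fromℕ 5 * (N * N)) - fromℕ 9 * (y * y - (s * y - p)) ≈⟨ +-congˡ (-‿cong (trans (*-congˡ r≈0) (zeroʳ _))) ⟩
        - (fromℕ 5 * (N * N)) - 0#                   ≈⟨ trans (+-congˡ -0#≈0#) (+-identityʳ _) ⟩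
        - (fromℕ 5 * (N * N))                        ∎
      C≈0 : C ≈ 0#
      C≈0 = begin
        C                                            ≈⟨ +-identityʳ C ⟨
        C + 0#                                       ≈⟨ +-congˡ (trans (*-congʳ D≈0) (zeroˡ y)) ⟨
        C + D * y                                    ≈⟨ C+Dy≈0 ⟩
        0#                                           ∎
      power′ : PowerRelation m y′
      power′ = x∙y⁻¹≈ε⇒x≈y _ _ (begin
        pow y′ n - Nᵐ * f′                           ≈⟨ power-residue quadratic′ ⟩
        C + D * y′                                   ≈⟨ +-cong C≈0 (trans (*-congʳ D≈0) (zeroˡ y′)) ⟩
        0# + 0#                                      ≈⟨ +-identityʳ 0# ⟩
        0#                                           ∎)
      X = (m ℕ.* n) ℕ.^ n ℕ.+ 5 ℕ.* (m ℕ.^ m ℕ.* m ℕ.^ m ℕ.* (m ℕ.* m))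
      X>0 : 0 ℕ.< X
      X>0 = ℕ.<-≤-trans (ℕ.m^n>0 (m ℕ.* n) {{ℕ.m*n≢0 m n}} n) (ℕ.m≤m+n _ _)
      fromℕX≈0 : fromℕ X ≈ fromℕ 0
      fromℕX≈0 = begin
        fromℕ X                                      ≈⟨ fromℕ-+ ((m ℕ.* n) ℕ.^ n) (5 ℕ.* (m ℕ.^ m ℕ.* m ℕ.^ m ℕ.* (m ℕ.* m))) ⟩
        fromℕ ((m ℕ.* n) ℕ.^ n) + fromℕ (5 ℕ.* (m ℕ.^ m ℕ.* m ℕ.^ m ℕ.* (m ℕ.* m)))
          ≈⟨ +-cong (trans (fromℕ-^ (m ℕ.* n) n) (pow-cong n (trans (fromℕ-* m n) (*-congˡ (fromℕ-+ 2 m)))))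
                    (trans (fromℕ-* 5 (m ℕ.^ m ℕ.* m ℕ.^ m ℕ.* (m ℕ.* m))) (*-congˡ (trans (fromℕ-* (m ℕ.^ m ℕ.* m ℕ.^ m) (m ℕ.* m))
                       (*-cong (trans (fromℕ-* (m ℕ.^ m) (m ℕ.^ m)) (*-cong (fromℕ-^ m m) (fromℕ-^ m m))) (fromℕ-* m m))))) ⟩
        pow p n + fromℕ 5 * ((Nᵐ * Nᵐ) * (N * N))    ≈⟨ +-congʳ (pow-cong n yy′≈p) ⟨
        pow (y * y′) n + fromℕ 5 * ((Nᵐ * Nᵐ) * (N * N)) ≈⟨ +-congʳ (pow-distrib-* y y′ n) ⟩
        pow y n * pow y′ n + fromℕ 5 * ((Nᵐ * Nᵐ) * (N * N)) ≈⟨ +-congʳ (*-cong power power′) ⟩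
        (Nᵐ * f) * (Nᵐ * f′) + fromℕ 5 * ((Nᵐ * Nᵐ) * (N * N))
          ≈⟨ solve 4 (λ Nᵐ F F′ N → (Nᵐ :* F) :* (Nᵐ :* F′) :+ con (+ 5) :* ((Nᵐ :* Nᵐ) :* (N :* N)) := (Nᵐ :* Nᵐ) :* (F :* F′ :+ con (+ 5) :* (N :* N))) refl Nᵐ f f′ N ⟩
        (Nᵐ * Nᵐ) * (f * f′ + fromℕ 5 * (N * N))    ≈⟨ *-congˡ (+-congʳ ff′) ⟩
        (Nᵐ * Nᵐ) * (- (fromℕ 5 * (N * N)) + fromℕ 5 * (N * N)) ≈⟨ trans (*-congˡ (-‿inverseˡ _)) (zeroʳ _) ⟩
        0#                                           ∎

    fromℕ-3[1+m]≈s : fromℕ (3 ℕ.* (1 ℕ.+ m)) ≈ s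
    fromℕ-3[1+m]≈s = trans (fromℕ-* 3 (1 ℕ.+ m)) (*-congˡ (fromℕ-+ 1 m))
    fromℕ-m[2+m]≈p : fromℕ (m ℕ.* (2 ℕ.+ m)) ≈ p
    fromℕ-m[2+m]≈p = trans (fromℕ-* m (2 ℕ.+ m)) (*-congˡ (fromℕ-+ 2 m))

    module _ (t : ℕ) where
      private
        st = suc t
        δ  = fromℕ st

      scaled-quadratic : ∀ {z} → δ * y ≈ z → z * z - (s * δ) * z + p * (δ * δ) ≈ 0#
      scaled-quadratic {z} δy≈z = begin
        z * z - (s * δ) * z + p * (δ * δ)                        ≈⟨ +-congʳ (+-cong (*-cong δy≈z δy≈z) (-‿cong (*-congˡ δy≈z))) ⟨
        (δ * y) * (δ * y) - (s * δ) * (δ * y) + p * (δ * δ)      ≈⟨ solve 4 (λ δ y s p → (δ :* y) :* (δ :* y) :- (s :* δ) :* (δ :* y) :+ p :* (δ :* δ) := (δ :* δ) :* (y :* y :- (s :* y :- p))) refl δ y s p ⟩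
        (δ * δ) * (y * y - (s * y - p))                          ≈⟨ trans (*-congˡ (quadratic-residue≈0 quadratic)) (zeroʳ _) ⟩
        0#                                                       ∎
      scaled-power : ∀ {z} → δ * y ≈ z → (1# + N) * pow z n + (Nᵐ * (z * z)) * pow δ m ≈ (Nᵐ * (N * N)) * pow δ n
      scaled-power {z} δy≈z = begin
        (1# + N) * pow z n + (Nᵐ * (z * z)) * pow δ m
          ≈⟨ +-cong (*-congˡ (pow-cong n δy≈z)) (*-congʳ (*-congˡ (*-cong δy≈z δy≈z))) ⟨
        (1# + N) * pow (δ * y) n + (Nᵐ * ((δ * y) * (δ * y))) * pow δ m
          ≈⟨ +-congʳ (*-congˡ (pow-distrib-* δ y n)) ⟩
        (1# + N) * (pow δ n * pow y n) + (Nᵐ * ((δ * y) * (δ * y))) * pow δ m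
          ≈⟨ solve 6 (λ δ y N Nᵐ Δ Y → (con (+ 1) :+ N) :* ((δ :* (δ :* Δ)) :* Y) :+ (Nᵐ :* ((δ :* y) :* (δ :* y))) :* Δ
                                       := (δ :* (δ :* Δ)) :* ((con (+ 1) :+ N) :* Y :+ Nᵐ :* (y :* y))) refl δ y N Nᵐ (pow δ m) (pow y n) ⟩
        pow δ n * ((1# + N) * pow y n + Nᵐ * (y * y))
          ≈⟨ *-congˡ (begin
               (1# + N) * pow y n + Nᵐ * (y * y)     ≈⟨ +-cong (*-congˡ power) (*-congˡ quadratic) ⟩
               (1# + N) * (Nᵐ * (fromℕ 2 * N - fromℕ 3 * y)) + Nᵐ * (s * y - p)
                 ≈⟨ solve 3 (λ N Nᵐ y → (con (+ 1) :+ N) :* (Nᵐ :* (con (+ 2) :* N :- con (+ 3) :* y)) :+ Nᵐ :* (con (+ 3) :* (con (+ 1) :+ N) :* y :- N :* (con (+ 2) :+ N)) := Nᵐ :* (N :* N)) refl N Nᵐ y ⟩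
               Nᵐ * (N * N)                          ∎) ⟩
        pow δ n * (Nᵐ * (N * N))                 ≈⟨ *-comm _ _ ⟩
        (Nᵐ * (N * N)) * pow δ n                 ∎
      rational-absurd : ∀ c → δ * y ≈ ι c → ⊥
      rational-absurd -[1+ w ] δy≈-W = X≢0 (fromℕ-injective {X} {0} (begin
        fromℕ X
          ≈⟨ trans (fromℕ-+ (sw ℕ.* sw ℕ.+ 3 ℕ.* (1 ℕ.+ m) ℕ.* st ℕ.* sw) (m ℕ.* (2 ℕ.+ m) ℕ.* (st ℕ.* st)))
               (+-cong (trans (fromℕ-+ (sw ℕ.* sw) (3 ℕ.* (1 ℕ.+ m) ℕ.* st ℕ.* sw))
                         (+-cong (fromℕ-* sw sw)
                           (trans (fromℕ-* (3 ℕ.* (1 ℕ.+ m) ℕ.* st) sw)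
                             (*-congʳ (trans (fromℕ-* (3 ℕ.* (1 ℕ.+ m)) st) (*-congʳ fromℕ-3[1+m]≈s))))))
                       (trans (fromℕ-* (m ℕ.* (2 ℕ.+ m)) (st ℕ.* st)) (*-cong fromℕ-m[2+m]≈p (fromℕ-* st st)))) ⟩
        W * W + (s * δ) * W + p * (δ * δ)        ≈⟨ solve 4 (λ W s δ p → W :* W :+ (s :* δ) :* W :+ p :* (δ :* δ) := (:- W) :* (:- W) :- (s :* δ) :* (:- W) :+ p :* (δ :* δ)) refl W s δ p ⟩
        (- W) * (- W) - (s * δ) * (- W) + p * (δ * δ) ≈⟨ scaled-quadratic δy≈-W ⟩
        0#                                       ∎))
        where
        sw = suc w
        W  = fromℕ sw
        X  = sw ℕ.* sw ℕ.+ 3 ℕ.* (1 ℕ.+ m) ℕ.* st ℕ.* sw ℕ.+ m ℕ.* (2 ℕ.+ m) ℕ.* (st ℕ.* st)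
        X≢0 : X ≢ 0
        X≢0 ()
      rational-absurd (+ e) δy≈E = NatBounds.quadratic-power-absurd {m} {e} {st}
        (fromℕ-injective quadratic-in-ℕ) (fromℕ-injective power-in-ℕ)
        where
        E = fromℕ e
        quadratic-in-ℕ : fromℕ (e ℕ.* e ℕ.+ m ℕ.* (2 ℕ.+ m) ℕ.* (st ℕ.* st)) ≈ fromℕ (3 ℕ.* (1 ℕ.+ m) ℕ.* e ℕ.* st)
        quadratic-in-ℕ = begin
          fromℕ (e ℕ.* e ℕ.+ m ℕ.* (2 ℕ.+ m) ℕ.* (st ℕ.* st))
            ≈⟨ trans (fromℕ-+ (e ℕ.* e) (m ℕ.* (2 ℕ.+ m) ℕ.* (st ℕ.* st)))
                 (+-cong (fromℕ-* e e) (trans (fromℕ-* (m ℕ.* (2 ℕ.+ m)) (st ℕ.* st)) (*-cong fromℕ-m[2+m]≈p (fromℕ-* st st)))) ⟩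
          E * E + p * (δ * δ)
            ≈⟨ x∙y⁻¹≈ε⇒x≈y _ _ (trans (solve 4 (λ E δ s p → (E :* E :+ p :* (δ :* δ)) :- (s :* E) :* δ := E :* E :- (s :* δ) :* E :+ p :* (δ :* δ)) refl E δ s p) (scaled-quadratic δy≈E)) ⟩
          (s * E) * δ
            ≈⟨ trans (fromℕ-* (3 ℕ.* (1 ℕ.+ m) ℕ.* e) st) (*-congʳ (trans (fromℕ-* (3 ℕ.* (1 ℕ.+ m)) e) (*-congʳ fromℕ-3[1+m]≈s))) ⟨
          fromℕ (3 ℕ.* (1 ℕ.+ m) ℕ.* e ℕ.* st) ∎
        power-in-ℕ : fromℕ ((1 ℕ.+ m) ℕ.* e ℕ.^ n ℕ.+ m ℕ.^ m ℕ.* (e ℕ.* e) ℕ.* st ℕ.^ m)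
                   ≈ fromℕ (m ℕ.^ m ℕ.* (m ℕ.* m) ℕ.* st ℕ.^ n)
        power-in-ℕ = begin
          fromℕ ((1 ℕ.+ m) ℕ.* e ℕ.^ n ℕ.+ m ℕ.^ m ℕ.* (e ℕ.* e) ℕ.* st ℕ.^ m)
            ≈⟨ trans (fromℕ-+ ((1 ℕ.+ m) ℕ.* e ℕ.^ n) (m ℕ.^ m ℕ.* (e ℕ.* e) ℕ.* st ℕ.^ m))
                 (+-cong (trans (fromℕ-* (1 ℕ.+ m) (e ℕ.^ n)) (*-cong (fromℕ-+ 1 m) (fromℕ-^ e n)))
                         (trans (fromℕ-* (m ℕ.^ m ℕ.* (e ℕ.* e)) (st ℕ.^ m))
                           (*-cong (trans (fromℕ-* (m ℕ.^ m) (e ℕ.* e)) (*-cong (fromℕ-^ m m) (fromℕ-* e e))) (fromℕ-^ st m)))) ⟩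
          (1# + N) * pow E n + (Nᵐ * (E * E)) * pow δ m ≈⟨ scaled-power δy≈E ⟩
          (Nᵐ * (N * N)) * pow δ n
            ≈⟨ trans (fromℕ-* (m ℕ.^ m ℕ.* (m ℕ.* m)) (st ℕ.^ n))
                 (*-cong (trans (fromℕ-* (m ℕ.^ m) (m ℕ.* m)) (*-cong (fromℕ-^ m m) (fromℕ-* m m))) (fromℕ-^ st n)) ⟨
          fromℕ (m ℕ.^ m ℕ.* (m ℕ.* m) ℕ.* st ℕ.^ n) ∎

    D≈ι⇒absurd : ∀ d → D ≈ ι d → ∀ c → C ≈ ι c → ⊥
    D≈ι⇒absurd (+ zero)  D≈0  _ _   = irrational-absurd D≈0
    D≈ι⇒absurd (+ suc t) D≈δ  c C≈c = rational-absurd t (ℤ.- c) (begin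
      fromℕ (suc t) * y       ≈⟨ *-congʳ D≈δ ⟨
      D * y                   ≈⟨ inverseʳ-unique C (D * y) C+Dy≈0 ⟩
      - C                     ≈⟨ -‿cong C≈c ⟩
      - ι c                   ≈⟨ ι-‿ c ⟨
      ι (ℤ.- c)               ∎)
    D≈ι⇒absurd -[1+ t ]  D≈-δ c C≈c = rational-absurd t c (begin
      fromℕ (suc t) * y       ≈⟨ solve 2 (λ δ y → δ :* y := :- ((:- δ) :* y)) refl (fromℕ (suc t)) y ⟩
      - (- fromℕ (suc t) * y) ≈⟨ -‿cong (*-congʳ D≈-δ) ⟨
      - (D * y)               ≈⟨ inverseˡ-unique C (D * y) C+Dy≈0 ⟨
      C                       ≈⟨ C≈c ⟩
      ι c                     ∎)

    quadratic∧power-absurd : ⊥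
    quadratic∧power-absurd = D≈ι⇒absurd (proj₁ D-isInteger) (proj₂ D-isInteger) (proj₁ C-isInteger) (proj₂ C-isInteger)

lemma1p25 : {c ℓ : Level} (K : ACF₀ c ℓ) (k : ℕ) → 2 ≤ k →
    ACF₀.HasNoMultipleRoots K (pk K k)
lemma1p25 K (suc m) (ℕ.s≤s m≥1) a a-multiple =
  quadratic∧power-absurd m {{ℕ.>-nonZero m≥1}} (proj₁ scaledRoot) (proj₂ scaledRoot)
  where
  open ACF₀ K using (_≈_; _*_; 0#; eval; trans; sym)
  open IntegerCoefficients (ACF₀.cring K) using (fromℕ)
  open CharacteristicZero K
  p≈0×p′≈0 : pk K (suc m) a ≈ 0# × eval (pk-quotient a (suc m)) a ≈ 0#
  p≈0×p′≈0 = multipleRoot⇒derivative≈0 (pk K (suc m)) a (pk-quotient a (suc m)) (pk-difference a (suc m)) a-multiple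
  scaledRoot : Quadratic m (fromℕ m * a) × PowerRelation m (fromℕ m * a)
  scaledRoot = scaledRoot-relations m a (proj₁ p≈0×p′≈0)
                 (trans (sym (eval-pk-quotient-at a (suc m))) (proj₂ p≈0×p′≈0))
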